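{- If a class of structures $\mathscr C$ is finitely monadically NIP, then $\mathscr C$ does not define large grids.
   Context: A class $\mathscr D$ is NIP if for every first-order formula $\phi(\bar x,\bar y)$ there is a finite bipartite graph $H$ that does not occur as an induced subgraph of the bipartite graph with parts $S^{\bar x},S^{\bar y}$ and edges $\{(\bar a,\bar b): S\models\phi(\bar a,\bar b)\}$ for any $S\in\mathscr D$. $\mathscr C$ is finitely monadically NIP if every expansion of $\mathscr C$ by finitely many unary predicates that are interpreted in the structures of $\mathscr C$ as finite sets is NIP. For $\phi(\bar x,\bar y,z)$ ($z$ a single variable), an $n\times n$ grid defined by $\phi$ in $S$ is $A\subseteq S^{\bar x}$, $B\subseteq S^{\bar y}$, $C\subseteq S$, $|A|=|B|=n$, $|C|=n^2$, with $\{(\bar a,\bar b,c)\in A\times B\times C: S\models\phi(\bar a,\bar b,c)\}$ the graph of a bijection $A\times B\to C$; $\mathscr C$ defines large grids if some $\phi$ defines an $n\times n$ grid in some member of $\mathscr C$ for every $n$. -}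

module Defs where

open import Data.Nat using (ℕ; suc; _+_; _*_)
open import Data.Fin using (Fin)
open import Data.Vec using (Vec; []; _∷_; lookup; map; head; _++_)
open import Data.List using (List)
open import Data.List.Membership.Propositional using (_∈_)
open import Data.Bool using (Bool; true; false)
open import Data.Product using (Σ; ∃; _×_; _,_)
open import Data.Sum using (_⊎_; inj₁; inj₂)
open import Data.Empty using (⊥)
open import Relation.Nullary using (¬_)
open import Relation.Binary.PropositionalEquality using (_≡_)
import Relation.Binary.PropositionalEquality as ≡
open import Function.Bundles using (Bijection)

record Signature : Set₁ where
  field
    Rel   : Set
    arity : Rel → ℕ
open Signature public

record Structure (L : Signature) : Set₁ where
  field
    Carrier : Set
    rel     : (R : Rel L) → Vec Carrier (arity L R) → Set
open Structure public

-- First-order formulas with free variables among Fin n (de Bruijn: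
-- a quantifier binds variable zero, shifting the others by one).
data Formula (L : Signature) : ℕ → Set where
  rel̇  : ∀ {n} (R : Rel L) → Vec (Fin n) (arity L R) → Formula L n
  _≐_  : ∀ {n} → Fin n → Fin n → Formula L n
  ⊥̇    : ∀ {n} → Formula L n
  ¬̇_   : ∀ {n} → Formula L n → Formula L n
  _∧̇_  : ∀ {n} → Formula L n → Formula L n → Formula L n
  _∨̇_  : ∀ {n} → Formula L n → Formula L n → Formula L n
  ∃̇_   : ∀ {n} → Formula L (suc n) → Formula L n
  ∀̇_   : ∀ {n} → Formula L (suc n) → Formula L n

_⊨_[_] : ∀ {L n} (S : Structure L) → Formula L n → Vec (Carrier S) n → Set
S ⊨ rel̇ R args [ ρ ] = rel S R (map (lookup ρ) args)
S ⊨ (i ≐ j)    [ ρ ] = lookup ρ i ≡ lookup ρ j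
S ⊨ ⊥̇          [ ρ ] = ⊥
S ⊨ (¬̇ φ)      [ ρ ] = ¬ (S ⊨ φ [ ρ ])
S ⊨ (φ ∧̇ ψ)    [ ρ ] = (S ⊨ φ [ ρ ]) × (S ⊨ ψ [ ρ ])
S ⊨ (φ ∨̇ ψ)    [ ρ ] = (S ⊨ φ [ ρ ]) ⊎ (S ⊨ ψ [ ρ ])
S ⊨ (∃̇ φ)      [ ρ ] = Σ (Carrier S) λ a → S ⊨ φ [ a ∷ ρ ]
S ⊨ (∀̇ φ)      [ ρ ] = (a : Carrier S) → S ⊨ φ [ a ∷ ρ ]

Class : Signature → Set₂
Class L = Structure L → Set₁

-- A finite bipartite graph H with parts Fin p, Fin q and edge relation E
-- occurs as an induced subgraph of the bipartite graph on S^k, S^l with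
-- edges given by φ(x̄,ȳ): injective maps of the parts such that edges
-- correspond exactly to satisfaction of φ.
Occurs : ∀ {L p q} k l (E : Fin p → Fin q → Bool) (S : Structure L)
         (φ : Formula L (k + l)) → Set
Occurs {p = p} {q} k l E S φ =
  Σ (Fin p → Vec (Carrier S) k) λ f →
  Σ (Fin q → Vec (Carrier S) l) λ g →
    (∀ i i′ → f i ≡ f i′ → i ≡ i′) ×
    (∀ j j′ → g j ≡ g j′ → j ≡ j′) ×
    (∀ i j → (E i j ≡ true  → S ⊨ φ [ f i ++ g j ]) ×
             (E i j ≡ false → ¬ (S ⊨ φ [ f i ++ g j ])))

NIP : ∀ {L} → Class L → Set₁
NIP {L} 𝒟 =
  ∀ k l (φ : Formula L (k + l)) →
    Σ ℕ λ p → Σ ℕ λ q → Σ (Fin p → Fin q → Bool) λ E →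
      ∀ S → 𝒟 S → ¬ Occurs k l E S φ

arityᵘ : (L : Signature) (m : ℕ) → Rel L ⊎ Fin m → ℕ
arityᵘ L m (inj₁ R) = arity L R
arityᵘ L m (inj₂ _) = 1

_+ᵘ_ : Signature → ℕ → Signature
L +ᵘ m = record { Rel = Rel L ⊎ Fin m ; arity = arityᵘ L m }

expand : ∀ {L m} (S : Structure L) → (Fin m → List (Carrier S)) → Structure (L +ᵘ m)
expand {L} {m} S P = record { Carrier = Carrier S ; rel = r }
  where
  r : (R : Rel L ⊎ Fin m) → Vec (Carrier S) (arityᵘ L m R) → Set
  r (inj₁ R) v = rel S R v
  r (inj₂ i) v = head v ∈ P i

FinUnaryExpansions : ∀ {L} → Class L → (m : ℕ) → Class (L +ᵘ m)
FinUnaryExpansions {L} 𝒞 m S′ =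
  Σ (Structure L) λ S → 𝒞 S ×
    Σ (Fin m → List (Carrier S)) λ P → S′ ≡ expand S P

FinitelyMonadicallyNIP : ∀ {L} → Class L → Set₁
FinitelyMonadicallyNIP 𝒞 = ∀ m → NIP (FinUnaryExpansions 𝒞 m)

-- φ(x̄,ȳ,z) with |x̄| = k, |ȳ| = l, z a single variable (the last one).
-- A = image of α, B = image of β, C = image of γ (injective enumerations,
-- so |A| = |B| = n, |C| = n²), and the set of triples (a,b,c) ∈ A×B×C
-- satisfying φ is the graph of a bijection h : A × B → C.
Grid : ∀ {L} k l (φ : Formula L (k + l + 1)) (S : Structure L) (n : ℕ) → Set
Grid k l φ S n =
  Σ (Fin n → Vec (Carrier S) k) λ α →
  Σ (Fin n → Vec (Carrier S) l) λ β →
  Σ (Fin (n * n) → Carrier S) λ γ →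
    (∀ i i′ → α i ≡ α i′ → i ≡ i′) ×
    (∀ j j′ → β j ≡ β j′ → j ≡ j′) ×
    (∀ r r′ → γ r ≡ γ r′ → r ≡ r′) ×
    Σ (Bijection (≡.setoid (Fin n × Fin n)) (≡.setoid (Fin (n * n)))) λ h →
      ∀ i j r → (S ⊨ φ [ (α i ++ β j) ++ (γ r ∷ []) ] →
                   γ r ≡ γ (Bijection.to h (i , j))) ×
                (γ r ≡ γ (Bijection.to h (i , j)) →
                   S ⊨ φ [ (α i ++ β j) ++ (γ r ∷ []) ])

DefinesLargeGrids : ∀ {L} → Class L → Set₁
DefinesLargeGrids {L} 𝒞 =
  Σ ℕ λ k → Σ ℕ λ l → Σ (Formula L (k + l + 1)) λ φ →
    ∀ n → Σ (Structure L) λ S → 𝒞 S × Grid k l φ S n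

-- Each row-column pair (i , j) of an n × n grid defined by φ(x̄,ȳ,z) owns a
-- private element h(i , j) of the grid, and φ links (i , j) to it alone.
-- Marking the elements h(i , j) for the edges (i , j) of a bipartite graph
-- H by a fresh unary predicate P, the formula ∃z (φ(x̄,ȳ,z) ∧ P z) cuts out
-- exactly H on the rows and columns of the grid.  So large grids put every
-- finite bipartite graph into the single formula ∃z (φ ∧ P z) over the
-- expansions by one finite predicate, which are therefore not NIP.
module Submission where

open import Defs
open import Data.Bool using (Bool; true; false; _≟_)
open import Data.Empty using (⊥)
open import Data.Fin using (Fin; zero; suc; lift; splitAt; _↑ˡ_; _↑ʳ_)
open import Data.Fin.Properties using (↑ˡ-injective; ↑ʳ-injective)
open import Data.List using (List; allFin; cartesianProduct; filter; map)
open import Data.List.Membership.Propositional using (_∈_)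
open import Data.List.Membership.Propositional.Properties
  using (∈-allFin; ∈-cartesianProduct⁺; ∈-map∘filter⁺; ∈-map∘filter⁻)
open import Data.Nat using (ℕ; suc; _+_)
open import Data.Product using (Σ; ∃; _×_; _,_; proj₁; proj₂)
open import Data.Product.Function.NonDependent.Propositional using (_×-⇔_)
import Data.Product.Function.Dependent.Propositional as Σ
open import Data.Sum using (inj₁; inj₂; [_,_])
open import Data.Sum.Function.Propositional using (_⊎-⇔_)
open import Data.Vec as Vec using (Vec; []; _∷_; lookup; _++_)
open import Data.Vec.Properties using (map-∘; map-cong; lookup-splitAt)
open import Function using (_∘_; const)
open import Function.Bundles using (Bijection; _⇔_; mk⇔; Equivalence)
open import Function.Construct.Identity using (⇔-id)
open import Function.Related.TypeIsomorphisms using (¬-cong-⇔)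
open import Relation.Binary.PropositionalEquality
  using (_≡_; refl; sym; trans; cong; subst; module ≡-Reasoning)
open import Relation.Nullary using (¬_; Dec)

private
  variable
    L : Signature
    m n k p q : ℕ

Π-cong-⇔ : ∀ {A : Set} {B C : A → Set} →
           (∀ a → B a ⇔ C a) → ((a : A) → B a) ⇔ ((a : A) → C a)
Π-cong-⇔ B⇔C = mk⇔ (λ f a → Equivalence.to (B⇔C a) (f a))
                   (λ f a → Equivalence.from (B⇔C a) (f a))

embed : (Fin n → Fin k) → Formula L n → Formula (L +ᵘ m) k
embed σ (rel̇ R args) = rel̇ (inj₁ R) (Vec.map σ args)
embed σ (i ≐ j)      = σ i ≐ σ j
embed σ ⊥̇            = ⊥̇
embed σ (¬̇ φ)        = ¬̇ embed σ φ
embed σ (φ ∧̇ ψ)      = embed σ φ ∧̇ embed σ ψ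
embed σ (φ ∨̇ ψ)      = embed σ φ ∨̇ embed σ ψ
embed σ (∃̇ φ)        = ∃̇ embed (lift 1 σ) φ
embed σ (∀̇ φ)        = ∀̇ embed (lift 1 σ) φ

lookup-lift : ∀ {A : Set} {σ : Fin n → Fin k} {ρ : Vec A n} {ρ′ : Vec A k} →
              (∀ i → lookup ρ′ (σ i) ≡ lookup ρ i) →
              ∀ a i → lookup (a ∷ ρ′) (lift 1 σ i) ≡ lookup (a ∷ ρ) i
lookup-lift σ-resp a zero    = refl
lookup-lift σ-resp a (suc i) = σ-resp i

module _ (S : Structure L) (P : Fin m → List (Carrier S)) where

  ⊨-embed : (σ : Fin n → Fin k) (φ : Formula L n)
            {ρ : Vec (Carrier S) n} {ρ′ : Vec (Carrier S) k} →
            (∀ i → lookup ρ′ (σ i) ≡ lookup ρ i) →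
            (expand S P ⊨ embed σ φ [ ρ′ ]) ⇔ (S ⊨ φ [ ρ ])
  ⊨-embed σ (rel̇ R args) {ρ} {ρ′} σ-resp =
    mk⇔ (subst (rel S R) args-resp) (subst (rel S R) (sym args-resp))
    where
    open ≡-Reasoning
    args-resp : Vec.map (lookup ρ′) (Vec.map σ args) ≡ Vec.map (lookup ρ) args
    args-resp = begin
      Vec.map (lookup ρ′) (Vec.map σ args) ≡⟨ map-∘ (lookup ρ′) σ args ⟨
      Vec.map (lookup ρ′ ∘ σ) args         ≡⟨ map-cong σ-resp args ⟩
      Vec.map (lookup ρ) args              ∎
  ⊨-embed σ (i ≐ j) σ-resp =
    mk⇔ (λ eq → trans (sym (σ-resp i)) (trans eq (σ-resp j)))
        (λ eq → trans (σ-resp i) (trans eq (sym (σ-resp j))))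
  ⊨-embed σ ⊥̇       σ-resp = ⇔-id ⊥
  ⊨-embed σ (¬̇ φ)   σ-resp = ¬-cong-⇔ (⊨-embed σ φ σ-resp)
  ⊨-embed σ (φ ∧̇ ψ) σ-resp = ⊨-embed σ φ σ-resp ×-⇔ ⊨-embed σ ψ σ-resp
  ⊨-embed σ (φ ∨̇ ψ) σ-resp = ⊨-embed σ φ σ-resp ⊎-⇔ ⊨-embed σ ψ σ-resp
  ⊨-embed σ (∃̇ φ)   σ-resp = Σ.congˡ (⊨-embed (lift 1 σ) φ (lookup-lift σ-resp _))
  ⊨-embed σ (∀̇ φ)   σ-resp = Π-cong-⇔ λ a → ⊨-embed (lift 1 σ) φ (lookup-lift σ-resp a)

lastToFront : Fin (n + 1) → Fin (suc n)
lastToFront {n} i = [ suc , const zero ] (splitAt n i)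

lookup-lastToFront : ∀ {A : Set} (a : A) (v : Vec A n) i →
                     lookup (a ∷ v) (lastToFront i) ≡ lookup (v ++ a ∷ []) i
lookup-lastToFront {n} a v i =
  trans (lookup-split (splitAt n i)) (sym (lookup-splitAt n v (a ∷ []) i))
  where
  lookup-split : ∀ s → lookup (a ∷ v) ([ suc , const zero ] s) ≡
                       [ lookup v , lookup (a ∷ []) ] s
  lookup-split (inj₁ j)    = refl
  lookup-split (inj₂ zero) = refl

∃marked : Formula L (n + 1) → Formula (L +ᵘ 1) n
∃marked φ = ∃̇ (embed lastToFront φ ∧̇ rel̇ (inj₂ zero) (zero ∷ []))

⊨-∃marked : (S : Structure L) (P : Fin 1 → List (Carrier S))
            (φ : Formula L (n + 1)) (v : Vec (Carrier S) n) →
            (expand S P ⊨ ∃marked φ [ v ]) ⇔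
            (∃ λ c → (S ⊨ φ [ v ++ c ∷ [] ]) × c ∈ P zero)
⊨-∃marked S P φ v =
  Σ.congˡ (⊨-embed S P lastToFront φ (lookup-lastToFront _ v) ×-⇔ ⇔-id _)

IsEdge : (Fin p → Fin q → Bool) → Fin p × Fin q → Set
IsEdge E (i , j) = E i j ≡ true

isEdge? : (E : Fin p → Fin q → Bool) (e : Fin p × Fin q) → Dec (IsEdge E e)
isEdge? E (i , j) = E i j ≟ true

allPairs : ∀ p q → List (Fin p × Fin q)
allPairs p q = cartesianProduct (allFin p) (allFin q)

edges : (Fin p → Fin q → Bool) → List (Fin p × Fin q)
edges {p} {q} E = filter (isEdge? E) (allPairs p q)

-- The row injection ι and the column injection κ may overlap: the grid
-- bijection keeps the cells of distinct pairs apart anyway.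
grid⇒occurs : ∀ {k l} {φ : Formula L (k + l + 1)} {S : Structure L} →
              Grid k l φ S n →
              (ι : Fin p → Fin n) → (∀ i i′ → ι i ≡ ι i′ → i ≡ i′) →
              (κ : Fin q → Fin n) → (∀ j j′ → κ j ≡ κ j′ → j ≡ j′) →
              (E : Fin p → Fin q → Bool) →
              Σ (Fin 1 → List (Carrier S)) λ P →
                Occurs k l E (expand S P) (∃marked φ)
grid⇒occurs {p = p} {q = q} {φ = φ} {S = S} (α , β , γ , α-inj , β-inj , γ-inj , h , graph)
            ι ι-inj κ κ-inj E =
  P , α ∘ ι , β ∘ κ ,
  (λ i i′ → ι-inj i i′ ∘ α-inj (ι i) (ι i′)) ,
  (λ j j′ → κ-inj j j′ ∘ β-inj (κ j) (κ j′)) ,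
  λ i j → edge⇒sat i j , non-edge⇒unsat i j
  where
  cell : Fin p × Fin q → Carrier S
  cell (i , j) = γ (Bijection.to h (ι i , κ j))

  cell-injective : ∀ e e′ → cell e ≡ cell e′ → e ≡ e′
  cell-injective (i , j) (i′ , j′) eq
    with refl ← ι-inj i i′ (cong proj₁ (Bijection.injective h (γ-inj _ _ eq)))
       | refl ← κ-inj j j′ (cong proj₂ (Bijection.injective h (γ-inj _ _ eq)))
    = refl

  P : Fin 1 → List (Carrier S)
  P zero = map cell (edges E)

  edge⇒sat : ∀ i j → E i j ≡ true → expand S P ⊨ ∃marked φ [ α (ι i) ++ β (κ j) ]
  edge⇒sat i j edge = Equivalence.from (⊨-∃marked S P φ _)
    ( cell (i , j)
    , proj₂ (graph (ι i) (κ j) _) refl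
    , ∈-map∘filter⁺ cell (isEdge? E)
        ((i , j) , ∈-cartesianProduct⁺ (∈-allFin i) (∈-allFin j) , refl , edge) )

  non-edge⇒unsat : ∀ i j → E i j ≡ false →
                   ¬ (expand S P ⊨ ∃marked φ [ α (ι i) ++ β (κ j) ])
  non-edge⇒unsat i j non-edge sat
    with c , φ-sat , c∈P ← Equivalence.to (⊨-∃marked S P φ _) sat
    with e , _ , refl , edge ← ∈-map∘filter⁻ cell (isEdge? E) {xs = allPairs p q} c∈P
    with refl ← cell-injective e (i , j) (proj₁ (graph (ι i) (κ j) _) φ-sat)
    with () ← trans (sym non-edge) edge

lemma8p8 : {L : Signature} (𝒞 : Class L) →
    FinitelyMonadicallyNIP 𝒞 → ¬ DefinesLargeGrids 𝒞
lemma8p8 𝒞 fmnip (k , l , φ , grids) =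
  let (p , q , E , E-absent) = fmnip 1 k l (∃marked φ)
      (S , S∈𝒞 , grid)       = grids (p + q)
      (P , E-occurs)         = grid⇒occurs {φ = φ} {S = S} grid
                                 (_↑ˡ q) (↑ˡ-injective q) (p ↑ʳ_) (↑ʳ-injective p) E
  in E-absent (expand S P) (S , S∈𝒞 , P , refl) E-occurs
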